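{- Let $k$ be a positive odd integer. Then there exists a tournament $T$ with $\det(T)=k^2$.
   Context: A tournament is a directed graph with exactly one arc between each pair of distinct vertices. For a tournament $T$ on vertices $v_1,\dots,v_n$, its skew-adjacency matrix is the $n\times n$ zero-diagonal matrix $S_T=[s_{ij}]$ with $s_{ij}=-s_{ji}=1$ if there is an arc from $v_i$ to $v_j$, and $\det(T):=\det(S_T)$. -}

module Defs where

open import Data.Nat using (ℕ; zero; suc)
open import Data.Integer using (ℤ; +_; -_; _+_; _*_)
open import Data.Fin using (Fin; zero; suc; punchIn)
open import Data.Bool using (Bool; true; false; T; not)
open import Data.Product using (_×_)
open import Relation.Binary.PropositionalEquality using (_≡_)
open import Relation.Nullary using (¬_)

record Tournament (n : ℕ) : Set where
  field
    arc         : Fin n → Fin n → Bool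
    irreflexive : ∀ i → arc i i ≡ false
    exactlyOne  : ∀ i j → ¬ (i ≡ j) → arc j i ≡ not (arc i j)

Matrix : ℕ → Set
Matrix n = Fin n → Fin n → ℤ

minor : ∀ {n} → Matrix (suc n) → Fin (suc n) → Matrix n
minor A j r c = A (suc r) (punchIn j c)

altSum : ∀ {n} → (Fin n → ℤ) → ℤ
altSum {zero}  f = + 0
altSum {suc n} f = f zero + - altSum (λ j → f (suc j))

det : ∀ {n} → Matrix n → ℤ
det {zero}  A = + 1
det {suc n} A = altSum (λ j → A zero j * det (minor A j))

skewAdj : ∀ {n} → Tournament n → Matrix n
skewAdj T i j with Tournament.arc T i j | Tournament.arc T j i
... | true  | _     = + 1
... | false | true  = - (+ 1)
... | false | false = + 0

detT : ∀ {n} → Tournament n → ℤ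
detT T = det (skewAdj T)

-- Take the transitive tournament on 0, …, N - 1 (N = 2m + 1) together with a vertex N that
-- beats exactly the odd vertices.  Subtracting from each column c < N - 1 of the skew-adjacency
-- matrix its right neighbour turns the transitive block into a lower bidiagonal block of -1's,
-- next to the columns of the vertices N - 1 and N.  Clearing the first row with the first
-- column and expanding along it removes one bidiagonal column at a time and changes the two
-- remaining columns only through alternating partial sums of their entries.  In the end the
-- 2 × 2 matrix left over has top row (0, N) and bottom-left entry -N, so the determinant is N².
module Submission where

open import Defs
open import Data.Nat using (ℕ; _*_; _%_; _<_)
open import Data.Integer using (+_)
open import Data.Product using (Σ)
open import Relation.Binary.PropositionalEquality using (_≡_)

open import Data.Bool using (Bool; true; false; if_then_else_; not; T)
open import Data.Empty using (⊥-elim)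
open import Data.Fin using (Fin; zero; suc; toℕ; punchIn; punchOut; fromℕ<)
import Data.Fin.Properties as Finₚ
open import Data.Integer using (ℤ; -_; _+_; _-_) renaming (_*_ to _·_)
import Data.Integer.Properties as ℤₚ
open import Data.Integer.Tactic.RingSolver using (solve-∀)
open import Data.Nat using (zero; suc; z≤n; s≤s; _≤_; _≡ᵇ_; _<ᵇ_)
import Data.Nat as ℕ
open import Data.Nat.DivMod using (_/_; m≡m%n+[m/n]*n)
import Data.Nat.Properties as ℕₚ
open import Data.Product using (_,_)
open import Data.Sum using (_⊎_; inj₁; inj₂)
open import Function using (_∘_)
open import Relation.Binary.Definitions using (tri<; tri≈; tri>)
open import Relation.Binary.PropositionalEquality
  using (_≢_; refl; sym; trans; cong; cong₂; subst; subst₂; module ≡-Reasoning)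
open import Relation.Nullary using (yes; no; does)
open import Relation.Nullary.Decidable using (dec-true; dec-false)

open ≡-Reasoning

altSum-cong : ∀ {n} {f g : Fin n → ℤ} → (∀ j → f j ≡ g j) → altSum f ≡ altSum g
altSum-cong {zero}  f≗g = refl
altSum-cong {suc n} f≗g = cong₂ _-_ (f≗g zero) (altSum-cong (f≗g ∘ suc))

altSum-+ : ∀ {n} (f g : Fin n → ℤ) → altSum (λ j → f j + g j) ≡ altSum f + altSum g
altSum-+ {zero}  f g = refl
altSum-+ {suc n} f g = begin
  f zero + g zero - altSum (λ j → f (suc j) + g (suc j))
    ≡⟨ cong (λ s → f zero + g zero - s) (altSum-+ (f ∘ suc) (g ∘ suc)) ⟩
  f zero + g zero - (altSum (f ∘ suc) + altSum (g ∘ suc))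
    ≡⟨ interchange (f zero) (g zero) (altSum (f ∘ suc)) (altSum (g ∘ suc)) ⟩
  (f zero - altSum (f ∘ suc)) + (g zero - altSum (g ∘ suc)) ∎
  where
  interchange : ∀ a b c d → a + b - (c + d) ≡ (a - c) + (b - d)
  interchange = solve-∀

altSum-· : ∀ {n} (l : ℤ) (f : Fin n → ℤ) → altSum (λ j → l · f j) ≡ l · altSum f
altSum-· {zero}  l f = sym (ℤₚ.*-zeroʳ l)
altSum-· {suc n} l f = begin
  l · f zero - altSum (λ j → l · f (suc j)) ≡⟨ cong (λ s → l · f zero - s) (altSum-· l (f ∘ suc)) ⟩
  l · f zero - l · altSum (f ∘ suc)         ≡⟨ distrib l (f zero) (altSum (f ∘ suc)) ⟩
  l · (f zero - altSum (f ∘ suc))           ∎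
  where
  distrib : ∀ l a b → l · a - l · b ≡ l · (a - b)
  distrib = solve-∀

altSum-zero : ∀ {n} (f : Fin n → ℤ) → (∀ j → f j ≡ + 0) → altSum f ≡ + 0
altSum-zero {zero}  f f≗0 = refl
altSum-zero {suc n} f f≗0 = cong₂ _-_ (f≗0 zero) (altSum-zero (f ∘ suc) (f≗0 ∘ suc))

altSum-adjacentCancel : ∀ {n} (f : Fin n → ℤ) (a : ℕ) → suc a < n →
  (∀ j → toℕ j ≢ a → toℕ j ≢ suc a → f j ≡ + 0) →
  (∀ j j′ → toℕ j ≡ a → toℕ j′ ≡ suc a → f j ≡ f j′) → altSum f ≡ + 0
altSum-adjacentCancel {suc (suc n)} f zero _ f-off f-eq = begin
  f zero - (f (suc zero) - altSum (λ j → f (suc (suc j))))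
    ≡⟨ cong₂ (λ y z → f zero - (y - z)) (sym (f-eq zero (suc zero) refl refl))
             (altSum-zero _ (λ j → f-off (suc (suc j)) (λ ()) (λ ()))) ⟩
  f zero - (f zero - + 0)
    ≡⟨ cancel (f zero) ⟩
  + 0 ∎
  where
  cancel : ∀ y → y - (y - + 0) ≡ + 0
  cancel = solve-∀
altSum-adjacentCancel {suc n} f (suc a) (s≤s sa<n) f-off f-eq =
  cong₂ _-_ (f-off zero (λ ()) (λ ()))
    (altSum-adjacentCancel (f ∘ suc) a sa<n
      (λ j j≢a j≢sa → f-off (suc j) (j≢a ∘ ℕₚ.suc-injective) (j≢sa ∘ ℕₚ.suc-injective))
      (λ j j′ j≡a j′≡sa → f-eq (suc j) (suc j′) (cong suc j≡a) (cong suc j′≡sa)))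

det-cong : ∀ {n} {A B : Matrix n} → (∀ r c → A r c ≡ B r c) → det A ≡ det B
det-cong {zero}  A≗B = refl
det-cong {suc n} A≗B =
  altSum-cong (λ j → cong₂ _·_ (A≗B zero j) (det-cong (λ r c → A≗B (suc r) (punchIn j c))))

det-2×2 : (A : Matrix 2) →
  det A ≡ A zero zero · A (suc zero) (suc zero) - A zero (suc zero) · A (suc zero) zero
det-2×2 A = expand (A zero zero) (A zero (suc zero)) (A (suc zero) zero) (A (suc zero) (suc zero))
  where
  expand : ∀ a b c d → a · (d · + 1 - + 0) - (b · (c · + 1 - + 0) - + 0) ≡ a · d - b · c
  expand = solve-∀

det-firstRowSingleton : ∀ {n} (A : Matrix (suc n)) → (∀ j → A zero (suc j) ≡ + 0) →
  det A ≡ A zero zero · det (minor A zero)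
det-firstRowSingleton A row₀ = begin
  A zero zero · det (minor A zero) - altSum (λ j → A zero (suc j) · det (minor A (suc j)))
    ≡⟨ cong (λ s → A zero zero · det (minor A zero) - s)
            (altSum-zero _ (λ j → cong (_· det (minor A (suc j))) (row₀ j))) ⟩
  A zero zero · det (minor A zero) - + 0
    ≡⟨ ℤₚ.+-identityʳ _ ⟩
  A zero zero · det (minor A zero) ∎

-- Multilinearity and alternation in the columns

toℕ-punchIn-< : ∀ {n} (j : Fin (suc n)) (c : Fin n) → toℕ c < toℕ j → toℕ (punchIn j c) ≡ toℕ c
toℕ-punchIn-< (suc j) zero    _         = refl
toℕ-punchIn-< (suc j) (suc c) (s≤s c<j) = cong suc (toℕ-punchIn-< j c c<j)

toℕ-punchIn-≥ : ∀ {n} (j : Fin (suc n)) (c : Fin n) → toℕ j ≤ toℕ c → toℕ (punchIn j c) ≡ suc (toℕ c)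
toℕ-punchIn-≥ zero    c       _         = refl
toℕ-punchIn-≥ (suc j) (suc c) (s≤s j≤c) = cong suc (toℕ-punchIn-≥ j c j≤c)

det-linear : ∀ {n} (A B C : Matrix n) (b : Fin n) (l : ℤ) →
  (∀ r → A r b ≡ B r b + l · C r b) →
  (∀ r c → c ≢ b → A r c ≡ B r c) → (∀ r c → c ≢ b → A r c ≡ C r c) →
  det A ≡ det B + l · det C
det-linear {suc n} A B C b l col-b A≗B A≗C = begin
  altSum (λ j → A zero j · det (minor A j))
    ≡⟨ altSum-cong term ⟩
  altSum (λ j → B zero j · det (minor B j) + l · (C zero j · det (minor C j)))
    ≡⟨ altSum-+ (λ j → B zero j · det (minor B j)) (λ j → l · (C zero j · det (minor C j))) ⟩
  det B + altSum (λ j → l · (C zero j · det (minor C j)))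
    ≡⟨ cong (λ s → det B + s) (altSum-· l (λ j → C zero j · det (minor C j))) ⟩
  det B + l · det C ∎
  where
  term : ∀ j → A zero j · det (minor A j) ≡ B zero j · det (minor B j) + l · (C zero j · det (minor C j))
  term j with j Data.Fin.≟ b
  ... | yes refl = begin
    A zero j · det (minor A j)                ≡⟨ cong (_· det (minor A j)) (col-b zero) ⟩
    (B zero j + l · C zero j) · det (minor A j)
      ≡⟨ distrib l (B zero j) (C zero j) (det (minor A j)) ⟩
    B zero j · det (minor A j) + l · (C zero j · det (minor A j))
      ≡⟨ cong₂ (λ y z → B zero j · y + l · (C zero j · z)) (det-cong (off-column A≗B)) (det-cong (off-column A≗C)) ⟩
    B zero j · det (minor B j) + l · (C zero j · det (minor C j)) ∎
    where
    distrib : ∀ l y z d → (y + l · z) · d ≡ y · d + l · (z · d)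
    distrib = solve-∀
    off-column : ∀ {D} → (∀ r c → c ≢ j → A r c ≡ D r c) → ∀ r c → minor A j r c ≡ minor D j r c
    off-column A≗D r c = A≗D (suc r) (punchIn j c) (Finₚ.punchInᵢ≢i j c)
  ... | no j≢b = begin
    A zero j · det (minor A j)
      ≡⟨ cong (A zero j ·_) (det-linear (minor A j) (minor B j) (minor C j) (punchOut j≢b) l
           (λ r → subst (λ c → A (suc r) c ≡ B (suc r) c + l · C (suc r) c)
                        (sym (Finₚ.punchIn-punchOut j≢b)) (col-b (suc r)))
           (λ r c c≢b → A≗B (suc r) (punchIn j c) (punched c≢b))
           (λ r c c≢b → A≗C (suc r) (punchIn j c) (punched c≢b))) ⟩
    A zero j · (det (minor B j) + l · det (minor C j))
      ≡⟨ distrib l (A zero j) (det (minor B j)) (det (minor C j)) ⟩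
    A zero j · det (minor B j) + l · (A zero j · det (minor C j))
      ≡⟨ cong₂ (λ y z → y · det (minor B j) + l · (z · det (minor C j))) (A≗B zero j j≢b) (A≗C zero j j≢b) ⟩
    B zero j · det (minor B j) + l · (C zero j · det (minor C j)) ∎
    where
    distrib : ∀ l a y z → a · (y + l · z) ≡ a · y + l · (a · z)
    distrib = solve-∀
    punched : ∀ {c} → c ≢ punchOut j≢b → punchIn j c ≢ b
    punched c≢b e = c≢b (Finₚ.punchIn-injective j _ _ (trans e (sym (Finₚ.punchIn-punchOut j≢b))))

det-additive : ∀ {n} (A B C : Matrix n) (b : Fin n) →
  (∀ r → A r b ≡ B r b + C r b) →
  (∀ r c → c ≢ b → A r c ≡ B r c) → (∀ r c → c ≢ b → A r c ≡ C r c) →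
  det A ≡ det B + det C
det-additive A B C b col-b A≗B A≗C = begin
  det A               ≡⟨ det-linear A B C b (+ 1) (λ r → trans (col-b r) (cong (λ s → B r b + s) (sym (ℤₚ.*-identityˡ (C r b))))) A≗B A≗C ⟩
  det B + + 1 · det C ≡⟨ cong (λ s → det B + s) (ℤₚ.*-identityˡ (det C)) ⟩
  det B + det C       ∎

AdjacentColumnsEqual : ∀ {n} → Matrix n → ℕ → Set
AdjacentColumnsEqual A a = ∀ r c c′ → toℕ c ≡ a → toℕ c′ ≡ suc a → A r c ≡ A r c′

minor-adjacentColumnsEqual-right : ∀ {n} (A : Matrix (suc n)) (j : Fin (suc n)) a →
  suc a < toℕ j → AdjacentColumnsEqual A a → AdjacentColumnsEqual (minor A j) a
minor-adjacentColumnsEqual-right A j a sa<j A-eq r c c′ c≡a c′≡sa =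
  A-eq (suc r) (punchIn j c) (punchIn j c′)
    (trans (toℕ-punchIn-< j c (subst (_< toℕ j) (sym c≡a) (ℕₚ.<-trans (ℕₚ.n<1+n a) sa<j))) c≡a)
    (trans (toℕ-punchIn-< j c′ (subst (_< toℕ j) (sym c′≡sa) sa<j)) c′≡sa)

minor-adjacentColumnsEqual-left : ∀ {n} (A : Matrix (suc n)) (j : Fin (suc n)) a →
  toℕ j ≤ a → AdjacentColumnsEqual A (suc a) → AdjacentColumnsEqual (minor A j) a
minor-adjacentColumnsEqual-left A j a j≤a A-eq r c c′ c≡a c′≡sa =
  A-eq (suc r) (punchIn j c) (punchIn j c′)
    (trans (toℕ-punchIn-≥ j c (subst (toℕ j ≤_) (sym c≡a) j≤a)) (cong suc c≡a))
    (trans (toℕ-punchIn-≥ j c′ (subst (toℕ j ≤_) (sym c′≡sa) (ℕₚ.m≤n⇒m≤1+n j≤a))) (cong suc c′≡sa))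

minor-adjacentColumnsEqual-same : ∀ {n} (A : Matrix (suc n)) a (j j′ : Fin (suc n)) →
  AdjacentColumnsEqual A a → toℕ j ≡ a → toℕ j′ ≡ suc a → ∀ r c → minor A j r c ≡ minor A j′ r c
minor-adjacentColumnsEqual-same A a j j′ A-eq j≡a j′≡sa r c with ℕₚ.<-cmp (toℕ c) a
... | tri< c<a _ _ = cong (A (suc r)) (Finₚ.toℕ-injective (begin
  toℕ (punchIn j c)  ≡⟨ toℕ-punchIn-< j c (subst (toℕ c <_) (sym j≡a) c<a) ⟩
  toℕ c              ≡⟨ toℕ-punchIn-< j′ c (subst (toℕ c <_) (sym j′≡sa) (ℕₚ.m<n⇒m<1+n c<a)) ⟨
  toℕ (punchIn j′ c) ∎))
... | tri≈ _ c≡a _ = sym (A-eq (suc r) (punchIn j′ c) (punchIn j c)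
  (trans (toℕ-punchIn-< j′ c (subst₂ _<_ (sym c≡a) (sym j′≡sa) (ℕₚ.n<1+n a))) c≡a)
  (trans (toℕ-punchIn-≥ j c (ℕₚ.≤-reflexive (trans j≡a (sym c≡a)))) (cong suc c≡a)))
... | tri> _ _ a<c = cong (A (suc r)) (Finₚ.toℕ-injective (begin
  toℕ (punchIn j c)  ≡⟨ toℕ-punchIn-≥ j c (subst (_≤ toℕ c) (sym j≡a) (ℕₚ.<⇒≤ a<c)) ⟩
  suc (toℕ c)        ≡⟨ toℕ-punchIn-≥ j′ c (subst (_≤ toℕ c) (sym j′≡sa) a<c) ⟨
  toℕ (punchIn j′ c) ∎))

det-adjacentColumnsEqual : ∀ {n} (A : Matrix n) a → suc a < n → AdjacentColumnsEqual A a → det A ≡ + 0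
det-adjacentColumnsEqual {suc n} A a sa<n A-eq =
  altSum-adjacentCancel (λ j → A zero j · det (minor A j)) a sa<n vanish equal
  where
  minor-vanishes : ∀ j → toℕ j ≢ a → toℕ j ≢ suc a → det (minor A j) ≡ + 0
  minor-vanishes j j≢a j≢sa with ℕₚ.<-cmp (toℕ j) a | ℕₚ.<-cmp (toℕ j) (suc a)
  ... | tri≈ _ j≡a _ | _            = ⊥-elim (j≢a j≡a)
  ... | _            | tri≈ _ j≡sa _ = ⊥-elim (j≢sa j≡sa)
  ... | tri> _ _ a<j | tri< j<sa _ _ = ⊥-elim (ℕₚ.<-irrefl refl (ℕₚ.<-≤-trans a<j (ℕₚ.≤-pred j<sa)))
  ... | tri> _ _ _   | tri> _ _ sa<j =
    det-adjacentColumnsEqual (minor A j) a (ℕₚ.<-≤-trans sa<j (ℕₚ.≤-pred (Finₚ.toℕ<n j)))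
      (minor-adjacentColumnsEqual-right A j a sa<j A-eq)
  ... | tri< j<a _ _ | _            = left-of a j<a sa<n A-eq
    where
    left-of : ∀ a → toℕ j < a → suc a < suc n → AdjacentColumnsEqual A a → det (minor A j) ≡ + 0
    left-of (suc a′) j<a (s≤s sa′<n) A-eq′ = det-adjacentColumnsEqual (minor A j) a′ sa′<n
      (minor-adjacentColumnsEqual-left A j a′ (ℕₚ.≤-pred j<a) A-eq′)
  vanish : ∀ j → toℕ j ≢ a → toℕ j ≢ suc a → A zero j · det (minor A j) ≡ + 0
  vanish j j≢a j≢sa = trans (cong (A zero j ·_) (minor-vanishes j j≢a j≢sa)) (ℤₚ.*-zeroʳ (A zero j))
  equal : ∀ j j′ → toℕ j ≡ a → toℕ j′ ≡ suc a → A zero j · det (minor A j) ≡ A zero j′ · det (minor A j′)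
  equal j j′ j≡a j′≡sa =
    cong₂ _·_ (A-eq zero j j′ j≡a j′≡sa) (det-cong (minor-adjacentColumnsEqual-same A a j j′ A-eq j≡a j′≡sa))

withColumns : ∀ {n} → Matrix n → Fin n → Fin n → (Fin n → ℤ) → (Fin n → ℤ) → Matrix n
withColumns A a a′ y z r c =
  if does (c Data.Fin.≟ a) then y r else if does (c Data.Fin.≟ a′) then z r else A r c

withColumns-first : ∀ {n} (A : Matrix n) a a′ y z r → withColumns A a a′ y z r a ≡ y r
withColumns-first A a a′ y z r rewrite dec-true (a Data.Fin.≟ a) refl = refl

withColumns-second : ∀ {n} (A : Matrix n) {a a′} y z r → a ≢ a′ → withColumns A a a′ y z r a′ ≡ z r
withColumns-second A {a} {a′} y z r a≢a′
  rewrite dec-false (a′ Data.Fin.≟ a) (a≢a′ ∘ sym) | dec-true (a′ Data.Fin.≟ a′) refl = refl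

withColumns-other : ∀ {n} (A : Matrix n) {a a′} y z r c → c ≢ a → c ≢ a′ → withColumns A a a′ y z r c ≡ A r c
withColumns-other A {a} {a′} y z r c c≢a c≢a′
  rewrite dec-false (c Data.Fin.≟ a) c≢a | dec-false (c Data.Fin.≟ a′) c≢a′ = refl

withColumns-cong-first : ∀ {n} (A : Matrix n) {a a′} y y′ z r c → c ≢ a →
  withColumns A a a′ y z r c ≡ withColumns A a a′ y′ z r c
withColumns-cong-first A {a} y y′ z r c c≢a rewrite dec-false (c Data.Fin.≟ a) c≢a = refl

withColumns-cong-second : ∀ {n} (A : Matrix n) {a a′} y z z′ r c → c ≢ a′ →
  withColumns A a a′ y z r c ≡ withColumns A a a′ y z′ r c
withColumns-cong-second A {a} {a′} y z z′ r c c≢a′ with does (c Data.Fin.≟ a)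
... | true  = refl
... | false rewrite dec-false (c Data.Fin.≟ a′) c≢a′ = refl

withColumns-own : ∀ {n} (A : Matrix n) a a′ r c → withColumns A a a′ (λ r → A r a) (λ r → A r a′) r c ≡ A r c
withColumns-own A a a′ r c with c Data.Fin.≟ a | c Data.Fin.≟ a′
... | yes refl | _        = refl
... | no _     | yes refl = refl
... | no _     | no _     = refl

adjacent⇒≢ : ∀ {n} {a a′ : Fin n} → toℕ a′ ≡ suc (toℕ a) → a ≢ a′
adjacent⇒≢ a′≡sa a≡a′ = ℕₚ.1+n≢n (sym (trans (cong toℕ a≡a′) a′≡sa))

_⊕_ : ∀ {n} → (Fin n → ℤ) → (Fin n → ℤ) → Fin n → ℤ
(y ⊕ z) r = y r + z r

det-withColumns-equal : ∀ {n} (A : Matrix n) (a a′ : Fin n) → toℕ a′ ≡ suc (toℕ a) →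
  ∀ y → det (withColumns A a a′ y y) ≡ + 0
det-withColumns-equal {n} A a a′ a′≡sa y =
  det-adjacentColumnsEqual _ (toℕ a) (subst (_< n) a′≡sa (Finₚ.toℕ<n a′)) λ r c c′ c≡a c′≡sa → begin
    withColumns A a a′ y y r c  ≡⟨ cong (withColumns A a a′ y y r) (Finₚ.toℕ-injective c≡a) ⟩
    withColumns A a a′ y y r a  ≡⟨ withColumns-first A a a′ y y r ⟩
    y r                         ≡⟨ withColumns-second A y y r (adjacent⇒≢ a′≡sa) ⟨
    withColumns A a a′ y y r a′ ≡⟨ cong (withColumns A a a′ y y r) (Finₚ.toℕ-injective (trans c′≡sa (sym a′≡sa))) ⟨
    withColumns A a a′ y y r c′ ∎

det-withColumns-additive-first : ∀ {n} (A : Matrix n) a a′ y y′ z →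
  det (withColumns A a a′ (y ⊕ y′) z) ≡ det (withColumns A a a′ y z) + det (withColumns A a a′ y′ z)
det-withColumns-additive-first A a a′ y y′ z = det-additive _ _ _ a
  (λ r → trans (withColumns-first A a a′ (y ⊕ y′) z r)
               (sym (cong₂ _+_ (withColumns-first A a a′ y z r) (withColumns-first A a a′ y′ z r))))
  (λ r c c≢a → withColumns-cong-first A (y ⊕ y′) y z r c c≢a)
  (λ r c c≢a → withColumns-cong-first A (y ⊕ y′) y′ z r c c≢a)

det-withColumns-additive-second : ∀ {n} (A : Matrix n) {a a′} y z z′ → a ≢ a′ →
  det (withColumns A a a′ y (z ⊕ z′)) ≡ det (withColumns A a a′ y z) + det (withColumns A a a′ y z′)
det-withColumns-additive-second A {a} {a′} y z z′ a≢a′ = det-additive _ _ _ a′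
  (λ r → trans (withColumns-second A y (z ⊕ z′) r a≢a′)
               (sym (cong₂ _+_ (withColumns-second A y z r a≢a′) (withColumns-second A y z′ r a≢a′))))
  (λ r c c≢a′ → withColumns-cong-second A y (z ⊕ z′) z r c c≢a′)
  (λ r c c≢a′ → withColumns-cong-second A y (z ⊕ z′) z′ r c c≢a′)

-- An alternating bilinear form is antisymmetric: expand Φ(u + v, u + v) = 0.
det-swapAdjacentColumns : ∀ {n} (A B : Matrix n) (a a′ : Fin n) → toℕ a′ ≡ suc (toℕ a) →
  (∀ r → B r a ≡ A r a′) → (∀ r → B r a′ ≡ A r a) → (∀ r c → c ≢ a → c ≢ a′ → B r c ≡ A r c) →
  det B ≡ - det A
det-swapAdjacentColumns {n} A B a a′ a′≡sa B-a B-a′ B-other = sum≡0⇒≡- (det B) (det A) (begin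
  det B + det A                      ≡⟨ cong₂ _+_ (det-cong B≗vu) (det-cong (λ r c → sym (withColumns-own A a a′ r c))) ⟩
  Φ v u + Φ u v                      ≡⟨ add-zeros (Φ u u) (Φ u v) (Φ v u) (Φ v v) (alternating u) (alternating v) ⟩
  (Φ u u + Φ u v) + (Φ v u + Φ v v)  ≡⟨ cong₂ _+_ (additive-second u u v) (additive-second v u v) ⟨
  Φ u (u ⊕ v) + Φ v (u ⊕ v)          ≡⟨ det-withColumns-additive-first A a a′ u v (u ⊕ v) ⟨
  Φ (u ⊕ v) (u ⊕ v)                  ≡⟨ alternating (u ⊕ v) ⟩
  + 0                                ∎)
  where
  u v : Fin n → ℤ
  u r = A r a
  v r = A r a′
  Φ : (Fin n → ℤ) → (Fin n → ℤ) → ℤ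
  Φ y z = det (withColumns A a a′ y z)
  alternating : ∀ y → Φ y y ≡ + 0
  alternating = det-withColumns-equal A a a′ a′≡sa
  additive-second : ∀ y z z′ → Φ y (z ⊕ z′) ≡ Φ y z + Φ y z′
  additive-second y z z′ = det-withColumns-additive-second A y z z′ (adjacent⇒≢ a′≡sa)
  B≗vu : ∀ r c → B r c ≡ withColumns A a a′ v u r c
  B≗vu r c with c Data.Fin.≟ a | c Data.Fin.≟ a′
  ... | yes refl | _        = B-a r
  ... | no _     | yes refl = B-a′ r
  ... | no c≢a   | no c≢a′  = B-other r c c≢a c≢a′
  add-zeros : ∀ p q s t → p ≡ + 0 → t ≡ + 0 → s + q ≡ (p + q) + (s + t)
  add-zeros p q s t refl refl = rearrange s q
    where
    rearrange : ∀ s q → s + q ≡ (+ 0 + q) + (s + + 0)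
    rearrange = solve-∀
  sum≡0⇒≡- : ∀ x y → x + y ≡ + 0 → x ≡ - y
  sum≡0⇒≡- x y x+y≡0 = trans (sym (cancel x y)) (trans (cong (_+ - y) x+y≡0) (ℤₚ.+-identityˡ (- y)))
    where
    cancel : ∀ x y → x + y + - y ≡ x
    cancel = solve-∀

-- Swap column b with its left neighbour b′ and recurse on the smaller distance to a.
det-equalColumns-distance : ∀ {n} d (A : Matrix n) (a b : Fin n) → toℕ b ≡ d ℕ.+ suc (toℕ a) →
  (∀ r → A r a ≡ A r b) → det A ≡ + 0
det-equalColumns-distance zero A a b b≡sa A-eq =
  det-adjacentColumnsEqual A (toℕ a) (subst (_< _) b≡sa (Finₚ.toℕ<n b)) λ r c c′ c≡a c′≡sa →
    trans (cong (A r) (Finₚ.toℕ-injective c≡a))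
      (trans (A-eq r) (cong (A r) (Finₚ.toℕ-injective (trans b≡sa (sym c′≡sa)))))
det-equalColumns-distance {n} (suc d) A a b b≡d+sa A-eq = begin
  det A       ≡⟨ ℤₚ.neg-involutive (det A) ⟨
  - - det A   ≡⟨ cong -_ (det-swapAdjacentColumns A B b′ b b≡sb′
                    (withColumns-first A b′ b colb colb′) (λ r → withColumns-second A colb colb′ r (adjacent⇒≢ b≡sb′))
                    (λ r c c≢b′ c≢b → withColumns-other A colb colb′ r c c≢b′ c≢b)) ⟨
  - det B     ≡⟨ cong -_ (det-equalColumns-distance d B a b′ b′≡d+sa B-eq) ⟩
  - + 0       ∎
  where
  b′<n : d ℕ.+ suc (toℕ a) < n
  b′<n = ℕₚ.<-trans (ℕₚ.n<1+n _) (subst (_< n) b≡d+sa (Finₚ.toℕ<n b))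
  b′ : Fin n
  b′ = fromℕ< b′<n
  b′≡d+sa : toℕ b′ ≡ d ℕ.+ suc (toℕ a)
  b′≡d+sa = Finₚ.toℕ-fromℕ< b′<n
  b≡sb′ : toℕ b ≡ suc (toℕ b′)
  b≡sb′ = trans b≡d+sa (cong suc (sym b′≡d+sa))
  a<b′ : toℕ a < toℕ b′
  a<b′ = subst (toℕ a <_) (sym b′≡d+sa) (ℕₚ.m≤n+m (suc (toℕ a)) d)
  a≢b′ : a ≢ b′
  a≢b′ a≡b′ = ℕₚ.<-irrefl (cong toℕ a≡b′) a<b′
  a≢b : a ≢ b
  a≢b a≡b = ℕₚ.<-irrefl (cong toℕ a≡b)
    (ℕₚ.<-trans a<b′ (subst₂ _<_ (sym b′≡d+sa) (sym b≡d+sa) (ℕₚ.n<1+n _)))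
  colb colb′ : Fin n → ℤ
  colb r = A r b
  colb′ r = A r b′
  B : Matrix n
  B = withColumns A b′ b colb colb′
  B-eq : ∀ r → B r a ≡ B r b′
  B-eq r = begin
    B r a   ≡⟨ withColumns-other A colb colb′ r a a≢b′ a≢b ⟩
    A r a   ≡⟨ A-eq r ⟩
    A r b   ≡⟨ withColumns-first A b′ b colb colb′ r ⟨
    B r b′  ∎

det-equalColumns : ∀ {n} (A : Matrix n) (a b : Fin n) → a ≢ b → (∀ r → A r a ≡ A r b) → det A ≡ + 0
det-equalColumns A a b a≢b A-eq with ℕₚ.<-cmp (toℕ a) (toℕ b)
... | tri< a<b _ _ = det-equalColumns-distance _ A a b (sym (ℕₚ.m∸n+n≡m a<b)) A-eq
... | tri≈ _ a≡b _ = ⊥-elim (a≢b (Finₚ.toℕ-injective a≡b))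
... | tri> _ _ b<a = det-equalColumns-distance _ A b a (sym (ℕₚ.m∸n+n≡m b<a)) (sym ∘ A-eq)

det-addColumn : ∀ {n} (A A′ : Matrix n) (a b : Fin n) (l : ℤ) → a ≢ b →
  (∀ r → A′ r b ≡ A r b + l · A r a) → (∀ r c → c ≢ b → A′ r c ≡ A r c) → det A′ ≡ det A
det-addColumn {n} A A′ a b l a≢b col-b A′≗A = begin
  det A′            ≡⟨ det-linear A′ A C b l
                         (λ r → trans (col-b r) (cong (λ s → A r b + l · s) (sym (withColumns-first A b a cola cola r))))
                         A′≗A (λ r c c≢b → trans (A′≗A r c c≢b) (sym (C-off r c c≢b))) ⟩
  det A + l · det C ≡⟨ cong (λ s → det A + l · s) (det-equalColumns C a b a≢b C-eq) ⟩
  det A + l · + 0   ≡⟨ cong (λ s → det A + s) (ℤₚ.*-zeroʳ l) ⟩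
  det A + + 0       ≡⟨ ℤₚ.+-identityʳ (det A) ⟩
  det A             ∎
  where
  cola : Fin n → ℤ
  cola r = A r a
  C : Matrix n
  C = withColumns A b a cola cola
  C-off : ∀ r c → c ≢ b → C r c ≡ A r c
  C-off r c c≢b with c Data.Fin.≟ a
  ... | yes refl rewrite dec-false (c Data.Fin.≟ b) c≢b = refl
  ... | no _     rewrite dec-false (c Data.Fin.≟ b) c≢b = refl
  C-eq : ∀ r → C r a ≡ C r b
  C-eq r = trans (C-off r a a≢b) (sym (withColumns-first A b a cola cola r))

≡ᵇ-refl : ∀ n → (n ≡ᵇ n) ≡ true
≡ᵇ-refl n = dec-true (n ℕ.≟ n) refl

≡ᵇ-true⇒≡ : ∀ {m n} → (m ≡ᵇ n) ≡ true → m ≡ n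
≡ᵇ-true⇒≡ {m} {n} e = ℕₚ.≡ᵇ⇒≡ m n (subst T (sym e) _)

≢⇒≡ᵇ-false : ∀ {m n} → m ≢ n → (m ≡ᵇ n) ≡ false
≢⇒≡ᵇ-false {m} {n} = dec-false (m ℕ.≟ n)

<⇒<ᵇ-true : ∀ {m n} → m < n → (m <ᵇ n) ≡ true
<⇒<ᵇ-true {m} {n} = dec-true (m ℕ.<? n)

≥⇒<ᵇ-false : ∀ {m n} → n ≤ m → (m <ᵇ n) ≡ false
≥⇒<ᵇ-false {m} {n} n≤m = dec-false (m ℕ.<? n) (ℕₚ.≤⇒≯ n≤m)

<ᵇ-suc : ∀ {c k} → c ≢ k → (c <ᵇ suc k) ≡ (c <ᵇ k)
<ᵇ-suc {c} {k} c≢k with ℕₚ.<-cmp c k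
... | tri< c<k _ _ rewrite <⇒<ᵇ-true c<k | <⇒<ᵇ-true (ℕₚ.m<n⇒m<1+n c<k) = refl
... | tri≈ _ c≡k _ = ⊥-elim (c≢k c≡k)
... | tri> _ _ k<c rewrite ≥⇒<ᵇ-false (ℕₚ.<⇒≤ k<c) | ≥⇒<ᵇ-false k<c = refl

-- Deleting the first row and column of restrict f shifts both indices of f.
restrict : ∀ {n} → (ℕ → ℕ → ℤ) → Matrix n
restrict f r c = f (toℕ r) (toℕ c)

addColumn : (ℕ → ℕ → ℤ) → ℕ → ℕ → ℤ → ℕ → ℕ → ℤ
addColumn f a b l r c = if c ≡ᵇ b then f r c + l · f r a else f r c

det-restrict-addColumn : ∀ {n} f {a b} l → a < n → b < n → a ≢ b →
  det (restrict {n} (addColumn f a b l)) ≡ det (restrict {n} f)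
det-restrict-addColumn f {a} {b} l a<n b<n a≢b =
  det-addColumn (restrict f) (restrict (addColumn f a b l)) (fromℕ< a<n) (fromℕ< b<n) l
    (λ a′≡b′ → a≢b (trans (sym (Finₚ.toℕ-fromℕ< a<n)) (trans (cong toℕ a′≡b′) (Finₚ.toℕ-fromℕ< b<n))))
    (λ r → begin
      addColumn f a b l (toℕ r) (toℕ (fromℕ< b<n))
        ≡⟨ cong (addColumn f a b l (toℕ r)) (Finₚ.toℕ-fromℕ< b<n) ⟩
      addColumn f a b l (toℕ r) b
        ≡⟨ cong (λ t → if t then f (toℕ r) b + l · f (toℕ r) a else f (toℕ r) b) (≡ᵇ-refl b) ⟩
      f (toℕ r) b + l · f (toℕ r) a
        ≡⟨ cong₂ (λ s t → f (toℕ r) s + l · f (toℕ r) t) (Finₚ.toℕ-fromℕ< b<n) (Finₚ.toℕ-fromℕ< a<n) ⟨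
      f (toℕ r) (toℕ (fromℕ< b<n)) + l · f (toℕ r) (toℕ (fromℕ< a<n)) ∎)
    (λ r c c≢b′ → cong (λ t → if t then f (toℕ r) (toℕ c) + l · f (toℕ r) a else f (toℕ r) (toℕ c))
      (≢⇒≡ᵇ-false (λ c≡b → c≢b′ (Finₚ.toℕ-injective (trans c≡b (sym (Finₚ.toℕ-fromℕ< b<n)))))))

differences : ℕ → (ℕ → ℕ → ℤ) → ℕ → ℕ → ℤ
differences k f r c = if c <ᵇ k then f r c - f r (suc c) else f r c

det-restrict-differences : ∀ {n} k f → k < n → det (restrict {n} (differences k f)) ≡ det (restrict {n} f)
det-restrict-differences zero    f _   = refl
det-restrict-differences {n} (suc k) f sk<n = begin
  det (restrict {n} (differences (suc k) f))
    ≡⟨ det-cong {n} (λ r c → differences-suc (toℕ r) (toℕ c)) ⟩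
  det (restrict {n} (addColumn (differences k f) (suc k) k (- + 1)))
    ≡⟨ det-restrict-addColumn (differences k f) (- + 1) sk<n k<n ℕₚ.1+n≢n ⟩
  det (restrict {n} (differences k f))
    ≡⟨ det-restrict-differences k f k<n ⟩
  det (restrict {n} f) ∎
  where
  k<n : k < n
  k<n = ℕₚ.<-trans (ℕₚ.n<1+n k) sk<n
  differences-suc : ∀ r c → differences (suc k) f r c ≡ addColumn (differences k f) (suc k) k (- + 1) r c
  differences-suc r c with c ℕ.≟ k
  ... | yes refl rewrite <⇒<ᵇ-true (ℕₚ.n<1+n c) | ≡ᵇ-refl c | ≥⇒<ᵇ-false (ℕₚ.≤-refl {c}) | ≥⇒<ᵇ-false (ℕₚ.n≤1+n c) =
    subtract (f r c) (f r (suc c))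
    where
    subtract : ∀ x y → x - y ≡ x + - + 1 · y
    subtract = solve-∀
  ... | no c≢k rewrite ≢⇒≡ᵇ-false c≢k | <ᵇ-suc c≢k = refl

-- Bordered bidiagonal matrices

-1^_ : ℕ → ℤ
-1^ zero    = + 1
-1^ (suc k) = - (-1^ k)

-- A column p₀, …, p_{j+1} of height j + 2, stored as its top entry p₀, its middle entries
-- p₁, …, p_j (middle r = p_{r+1}) and its bottom entry p_{j+1}: elimination shifts the
-- middle part and changes only the two ends.
record BorderColumn : Set where
  field
    top    : ℤ
    middle : ℕ → ℤ
    bottom : ℤ
open BorderColumn

column : ℕ → BorderColumn → ℕ → ℤ
column j p zero    = top p
column j p (suc r) = if r ≡ᵇ j then bottom p else middle p r

δ : ℕ → ℕ → ℤ
δ r c = if r ≡ᵇ c then + 1 else + 0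

bidiagonal : ℕ → (ℕ → ℤ) → ℕ → ℕ → ℤ
bidiagonal j x r c = - δ r c - δ r (suc c) + δ r (suc j) · x c

--   -1                        p₀       q₀
--   -1   -1                   p₁       q₁
--        -1   ⋱               ⋮        ⋮
--              ⋱   -1
--                  -1         p_j      q_j
--   x₀   x₁   …    x_{j-1}    p_{j+1}  q_{j+1}
borderedBidiagonalEntry : ℕ → (ℕ → ℤ) → BorderColumn → BorderColumn → ℕ → ℕ → ℤ
borderedBidiagonalEntry j x p q r c =
  if c <ᵇ j then bidiagonal j x r c else if c ≡ᵇ j then column j p r else column j q r

borderedBidiagonal : (j : ℕ) → (ℕ → ℤ) → BorderColumn → BorderColumn → Matrix (suc (suc j))
borderedBidiagonal j x p q = restrict (borderedBidiagonalEntry j x p q)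

eliminate : ℤ → BorderColumn → BorderColumn
eliminate x₀ p = record
  { top    = middle p 0 - top p
  ; middle = middle p ∘ suc
  ; bottom = bottom p + top p · x₀
  }

column-eliminate : ∀ j x p r →
  column j (eliminate (x 0) p) r ≡ column (suc j) p (suc r) + top p · bidiagonal (suc j) x (suc r) 0
column-eliminate j x p zero = clear (middle p 0) (top p)
  where
  clear : ∀ m t → m - t ≡ m + t · (- + 0 - + 1 + + 0)
  clear = solve-∀
column-eliminate j x p (suc r) with r ≡ᵇ j
... | true  = add (bottom p) (top p) (x 0)
  where
  add : ∀ b t y → b + t · y ≡ b + t · (- + 0 - + 0 + + 1 · y)
  add = solve-∀
... | false = keep (middle p (suc r)) (top p) (x 0)
  where
  keep : ∀ m t y → m ≡ m + t · (- + 0 - + 0 + + 0 · y)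
  keep = solve-∀

columnCases : ∀ {j c} → c ≤ suc j → c < j ⊎ c ≡ j ⊎ c ≡ suc j
columnCases {j} {c} c≤sj with ℕₚ.<-cmp c j
... | tri< c<j _ _ = inj₁ c<j
... | tri≈ _ c≡j _ = inj₂ (inj₁ c≡j)
... | tri> _ _ j<c = inj₂ (inj₂ (ℕₚ.≤-antisym c≤sj j<c))

-- Clearing the first row with the first column, then expanding along it.
det-borderedBidiagonal-step : ∀ j x p q →
  det (borderedBidiagonal (suc j) x p q) ≡
    - det (borderedBidiagonal j (x ∘ suc) (eliminate (x 0) p) (eliminate (x 0) q))
det-borderedBidiagonal-step j x p q = begin
  det (restrict {3+j} H)
    ≡⟨ det-restrict-addColumn {3+j} H (top p) (s≤s z≤n) (ℕₚ.<-trans (ℕₚ.n<1+n (suc j)) (ℕₚ.n<1+n _)) (λ ()) ⟨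
  det (restrict {3+j} H₁)
    ≡⟨ det-restrict-addColumn {3+j} H₁ (top q) (s≤s z≤n) (ℕₚ.n<1+n _) (λ ()) ⟨
  det (restrict {3+j} H₂)
    ≡⟨ det-firstRowSingleton (restrict {3+j} H₂) (λ c → first-row (toℕ c) (ℕₚ.≤-pred (Finₚ.toℕ<n c))) ⟩
  - + 1 · det (minor (restrict {3+j} H₂) zero)
    ≡⟨ cong (λ d → - + 1 · d) (det-cong {suc (suc j)} (λ r c → reduced (toℕ r) (toℕ c) (ℕₚ.≤-pred (Finₚ.toℕ<n c)))) ⟩
  - + 1 · det (borderedBidiagonal j (x ∘ suc) p′ q′)
    ≡⟨ ℤₚ.-1*i≡-i _ ⟩
  - det (borderedBidiagonal j (x ∘ suc) p′ q′) ∎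
  where
  3+j : ℕ
  3+j = suc (suc (suc j))
  H H₁ H₂ : ℕ → ℕ → ℤ
  H  = borderedBidiagonalEntry (suc j) x p q
  H₁ = addColumn H 0 (suc j) (top p)
  H₂ = addColumn H₁ 0 (suc (suc j)) (top q)
  p′ q′ : BorderColumn
  p′ = eliminate (x 0) p
  q′ = eliminate (x 0) q
  cancel : ∀ t → t + t · (- + 1) ≡ + 0
  cancel = solve-∀
  first-row : ∀ c → c ≤ suc j → H₂ 0 (suc c) ≡ + 0
  first-row c c≤sj with columnCases c≤sj
  ... | inj₁ c<j rewrite ≢⇒≡ᵇ-false (ℕₚ.<⇒≢ (ℕₚ.m<n⇒m<1+n c<j)) | ≢⇒≡ᵇ-false (ℕₚ.<⇒≢ c<j) | <⇒<ᵇ-true c<j = refl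
  ... | inj₂ (inj₁ refl) rewrite ≢⇒≡ᵇ-false (ℕₚ.<⇒≢ (ℕₚ.n<1+n c)) | ≡ᵇ-refl c | ≥⇒<ᵇ-false (ℕₚ.≤-refl {c}) = cancel (top p)
  ... | inj₂ (inj₂ refl) rewrite ≡ᵇ-refl c | ≢⇒≡ᵇ-false (ℕₚ.1+n≢n {j}) | ≥⇒<ᵇ-false (ℕₚ.n≤1+n j) = cancel (top q)
  reduced : ∀ r c → c ≤ suc j → H₂ (suc r) (suc c) ≡ borderedBidiagonalEntry j (x ∘ suc) p′ q′ r c
  reduced r c c≤sj with columnCases c≤sj
  ... | inj₁ c<j rewrite ≢⇒≡ᵇ-false (ℕₚ.<⇒≢ (ℕₚ.m<n⇒m<1+n c<j)) | ≢⇒≡ᵇ-false (ℕₚ.<⇒≢ c<j) | <⇒<ᵇ-true c<j = refl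
  ... | inj₂ (inj₁ refl) rewrite ≢⇒≡ᵇ-false (ℕₚ.<⇒≢ (ℕₚ.n<1+n c)) | ≡ᵇ-refl c | ≥⇒<ᵇ-false (ℕₚ.≤-refl {c}) =
    sym (column-eliminate c x p r)
  ... | inj₂ (inj₂ refl) rewrite ≡ᵇ-refl c | ≢⇒≡ᵇ-false (ℕₚ.1+n≢n {j}) | ≥⇒<ᵇ-false (ℕₚ.n≤1+n j) =
    sym (column-eliminate j x q r)

topAfter : BorderColumn → ℕ → ℤ
topAfter p zero    = top p
topAfter p (suc k) = middle p k - topAfter p k

bottomAfter : (ℕ → ℤ) → BorderColumn → ℕ → ℤ
bottomAfter x p zero    = bottom p
bottomAfter x p (suc k) = bottomAfter x p k + topAfter p k · x k

topAfter-eliminate : ∀ x₀ p k → topAfter (eliminate x₀ p) k ≡ topAfter p (suc k)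
topAfter-eliminate x₀ p zero    = refl
topAfter-eliminate x₀ p (suc k) = cong (λ t → middle p (suc k) - t) (topAfter-eliminate x₀ p k)

bottomAfter-eliminate : ∀ x p k → bottomAfter (x ∘ suc) (eliminate (x 0) p) k ≡ bottomAfter x p (suc k)
bottomAfter-eliminate x p zero    = refl
bottomAfter-eliminate x p (suc k) =
  cong₂ (λ b t → b + t · x (suc k)) (bottomAfter-eliminate x p k) (topAfter-eliminate (x 0) p k)

det-borderedBidiagonal : ∀ j x p q →
  det (borderedBidiagonal j x p q) ≡ -1^ j · (topAfter p j · bottomAfter x q j - topAfter q j · bottomAfter x p j)
det-borderedBidiagonal zero x p q = trans (det-2×2 (borderedBidiagonal zero x p q)) (sym (ℤₚ.*-identityˡ _))
det-borderedBidiagonal (suc j) x p q = begin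
  det (borderedBidiagonal (suc j) x p q)                    ≡⟨ det-borderedBidiagonal-step j x p q ⟩
  - det (borderedBidiagonal j (x ∘ suc) p′ q′)              ≡⟨ cong -_ (det-borderedBidiagonal j (x ∘ suc) p′ q′) ⟩
  - (-1^ j · (topAfter p′ j · bottomAfter (x ∘ suc) q′ j - topAfter q′ j · bottomAfter (x ∘ suc) p′ j))
    ≡⟨ cong (λ d → - (-1^ j · d)) (cong₂ _-_
         (cong₂ _·_ (topAfter-eliminate (x 0) p j) (bottomAfter-eliminate x q j))
         (cong₂ _·_ (topAfter-eliminate (x 0) q j) (bottomAfter-eliminate x p j))) ⟩
  - (-1^ j · (topAfter p (suc j) · bottomAfter x q (suc j) - topAfter q (suc j) · bottomAfter x p (suc j)))
    ≡⟨ ℤₚ.neg-distribˡ-* (-1^ j) _ ⟩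
  -1^ (suc j) · (topAfter p (suc j) · bottomAfter x q (suc j) - topAfter q (suc j) · bottomAfter x p (suc j)) ∎
  where
  p′ q′ : BorderColumn
  p′ = eliminate (x 0) p
  q′ = eliminate (x 0) q

-- Tournaments from skew-symmetric sign matrices

skewTournament : ∀ {n} (S : Matrix n) → (∀ i → S i i ≡ + 0) → (∀ i j → S j i ≡ - S i j) →
  (∀ i j → i ≢ j → S i j ≡ + 1 ⊎ S i j ≡ - + 1) → Tournament n
skewTournament {n} S diagonal antisym unit = record
  { arc         = arc
  ; irreflexive = irreflexive
  ; exactlyOne  = exactlyOne
  }
  where
  arc : Fin n → Fin n → Bool
  arc i j = does (S i j ℤₚ.≟ + 1)
  irreflexive : ∀ i → arc i i ≡ false
  irreflexive i rewrite diagonal i = refl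
  exactlyOne : ∀ i j → i ≢ j → arc j i ≡ not (arc i j)
  exactlyOne i j i≢j rewrite antisym i j with unit i j i≢j
  ... | inj₁ Sij≡1  rewrite Sij≡1 = refl
  ... | inj₂ Sij≡-1 rewrite Sij≡-1 = refl

skewAdj-skewTournament : ∀ {n} (S : Matrix n) diagonal antisym unit i j →
  skewAdj (skewTournament S diagonal antisym unit) i j ≡ S i j
skewAdj-skewTournament S diagonal antisym unit i j with S i j ℤₚ.≟ + 1 | S j i ℤₚ.≟ + 1
... | yes Sij≡1 | _         = sym Sij≡1
... | no _      | yes Sji≡1 = sym (trans (antisym j i) (cong -_ Sji≡1))
... | no Sij≢1  | no Sji≢1  with i Data.Fin.≟ j
...   | yes refl = sym (diagonal i)
...   | no i≢j with unit i j i≢j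
...     | inj₁ Sij≡1  = ⊥-elim (Sij≢1 Sij≡1)
...     | inj₂ Sij≡-1 = ⊥-elim (Sji≢1 (trans (antisym i j) (cong -_ Sij≡-1)))

-- The tournament

-1^-unit : ∀ k → -1^ k ≡ + 1 ⊎ -1^ k ≡ - + 1
-1^-unit zero = inj₁ refl
-1^-unit (suc k) with -1^-unit k
... | inj₁ e = inj₂ (cong -_ e)
... | inj₂ e = inj₁ (cong -_ e)

-1^-even : ∀ m → -1^ (m * 2) ≡ + 1
-1^-even zero    = refl
-1^-even (suc m) = trans (ℤₚ.neg-involutive (-1^ (m * 2))) (-1^-even m)

transitive : ℕ → ℕ → ℤ
transitive zero    zero    = + 0
transitive zero    (suc c) = + 1
transitive (suc r) zero    = - + 1
transitive (suc r) (suc c) = transitive r c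

transitive-refl : ∀ r → transitive r r ≡ + 0
transitive-refl zero    = refl
transitive-refl (suc r) = transitive-refl r

transitive-antisym : ∀ r c → transitive c r ≡ - transitive r c
transitive-antisym zero    zero    = refl
transitive-antisym zero    (suc c) = refl
transitive-antisym (suc r) zero    = refl
transitive-antisym (suc r) (suc c) = transitive-antisym r c

transitive-unit : ∀ {r c} → r ≢ c → transitive r c ≡ + 1 ⊎ transitive r c ≡ - + 1
transitive-unit {zero}  {zero}  r≢c = ⊥-elim (r≢c refl)
transitive-unit {zero}  {suc c} _   = inj₁ refl
transitive-unit {suc r} {zero}  _   = inj₂ refl
transitive-unit {suc r} {suc c} r≢c = transitive-unit (r≢c ∘ cong suc)

transitive-< : ∀ {r c} → r < c → transitive r c ≡ + 1
transitive-< {zero}  {suc c} _         = refl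
transitive-< {suc r} {suc c} (s≤s r<c) = transitive-< r<c

transitive-differences : ∀ r c → transitive r c - transitive r (suc c) ≡ - δ r c - δ r (suc c)
transitive-differences zero          zero    = refl
transitive-differences zero          (suc c) = refl
transitive-differences (suc zero)    zero    = refl
transitive-differences (suc (suc r)) zero    = refl
transitive-differences (suc r)       (suc c) = transitive-differences r c

skew : ℕ → ℕ → ℕ → ℤ
skew N r c =
  if r ≡ᵇ N then (if c ≡ᵇ N then + 0 else - -1^ c)
  else (if c ≡ᵇ N then -1^ r else transitive r c)

skew-diagonal : ∀ N r → skew N r r ≡ + 0
skew-diagonal N r with r ≡ᵇ N
... | true  = refl
... | false = transitive-refl r

skew-antisym : ∀ N r c → skew N c r ≡ - skew N r c
skew-antisym N r c with r ≡ᵇ N | c ≡ᵇ N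
... | true  | true  = refl
... | true  | false = sym (ℤₚ.neg-involutive (-1^ c))
... | false | true  = refl
... | false | false = transitive-antisym r c

skew-unit : ∀ N {r c} → r ≢ c → skew N r c ≡ + 1 ⊎ skew N r c ≡ - + 1
skew-unit N {r} {c} r≢c with r ≡ᵇ N in r≡N | c ≡ᵇ N in c≡N
... | true  | true  = ⊥-elim (r≢c (trans (≡ᵇ-true⇒≡ r≡N) (sym (≡ᵇ-true⇒≡ c≡N))))
... | true  | false with -1^-unit c
...   | inj₁ e = inj₂ (cong -_ e)
...   | inj₂ e = inj₁ (cong -_ e)
skew-unit N {r} r≢c | false | true  = -1^-unit r
skew-unit N r≢c | false | false = transitive-unit r≢c

skew-transitive : ∀ {N r c} → r < N → c < N → skew N r c ≡ transitive r c
skew-transitive r<N c<N rewrite ≢⇒≡ᵇ-false (ℕₚ.<⇒≢ r<N) | ≢⇒≡ᵇ-false (ℕₚ.<⇒≢ c<N) = refl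

skew-lastColumn : ∀ {N r} → r < N → skew N r N ≡ -1^ r
skew-lastColumn {N} r<N rewrite ≢⇒≡ᵇ-false (ℕₚ.<⇒≢ r<N) | ≡ᵇ-refl N = refl

skew-lastRow : ∀ {N c} → c < N → skew N N c ≡ - -1^ c
skew-lastRow {N} c<N rewrite ≡ᵇ-refl N | ≢⇒≡ᵇ-false (ℕₚ.<⇒≢ c<N) = refl

borderOf : (ℕ → ℕ → ℤ) → ℕ → ℕ → BorderColumn
borderOf f j c = record { top = f 0 c ; middle = λ r → f (suc r) c ; bottom = f (suc j) c }

column-borderOf : ∀ f j c r → column j (borderOf f j c) r ≡ f r c
column-borderOf f j c zero = refl
column-borderOf f j c (suc r) with r ℕ.≟ j
... | yes refl rewrite ≡ᵇ-refl r = refl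
... | no r≢j   rewrite ≢⇒≡ᵇ-false r≢j = refl

module _ (m : ℕ) where

  private
    E N : ℕ
    E = m * 2
    N = suc E

    diagonal : ∀ (i : Fin (suc N)) → skew N (toℕ i) (toℕ i) ≡ + 0
    diagonal i = skew-diagonal N (toℕ i)
    antisym : ∀ (i j : Fin (suc N)) → skew N (toℕ j) (toℕ i) ≡ - skew N (toℕ i) (toℕ j)
    antisym i j = skew-antisym N (toℕ i) (toℕ j)
    unit : ∀ (i j : Fin (suc N)) → i ≢ j → skew N (toℕ i) (toℕ j) ≡ + 1 ⊎ skew N (toℕ i) (toℕ j) ≡ - + 1
    unit i j i≢j = skew-unit N (i≢j ∘ Finₚ.toℕ-injective)

  tournament : Tournament (suc N)
  tournament = skewTournament (restrict (skew N)) diagonal antisym unit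

  lastRow : ℕ → ℤ
  lastRow c = -1^ (suc c) - -1^ c

  colE colN : BorderColumn
  colE = borderOf (skew N) E E
  colN = borderOf (skew N) E N

  differences-skew : ∀ r c → r ≤ N → c ≤ N →
    differences E (skew N) r c ≡ borderedBidiagonalEntry E lastRow colE colN r c
  differences-skew r c r≤N c≤N with columnCases c≤N
  ... | inj₁ c<E rewrite <⇒<ᵇ-true c<E with ℕₚ.m≤n⇒m<n∨m≡n r≤N
  ...   | inj₁ r<N rewrite skew-transitive r<N (ℕₚ.m<n⇒m<1+n c<E) | skew-transitive r<N (s≤s c<E)
                         | ≢⇒≡ᵇ-false (ℕₚ.<⇒≢ r<N) =
    trans (transitive-differences r c) (sym (ℤₚ.+-identityʳ _))
  ...   | inj₂ refl rewrite skew-lastRow (ℕₚ.m<n⇒m<1+n c<E) | skew-lastRow (s≤s c<E) | ≡ᵇ-refl r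
                          | ≢⇒≡ᵇ-false (ℕₚ.<⇒≢ (ℕₚ.m<n⇒m<1+n c<E) ∘ sym)
                          | ≢⇒≡ᵇ-false (ℕₚ.<⇒≢ (s≤s c<E) ∘ sym) = lastRow-entry (-1^ c)
    where
    lastRow-entry : ∀ s → - s - - - s ≡ - + 0 - + 0 + + 1 · (- s - s)
    lastRow-entry = solve-∀
  differences-skew r c r≤N c≤N | inj₂ (inj₁ refl) rewrite ≥⇒<ᵇ-false (ℕₚ.≤-refl {c}) | ≡ᵇ-refl c =
    sym (column-borderOf (skew N) E E r)
  differences-skew r c r≤N c≤N | inj₂ (inj₂ refl) rewrite ≥⇒<ᵇ-false (ℕₚ.n≤1+n E) | ≢⇒≡ᵇ-false (ℕₚ.1+n≢n {E}) =
    sym (column-borderOf (skew N) E N r)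

  topAfter-colN : ∀ k → k ≤ E → topAfter colN k ≡ -1^ k · + suc k
  topAfter-colN zero    _     = skew-lastColumn {N} {0} (s≤s z≤n)
  topAfter-colN (suc k) sk≤E rewrite skew-lastColumn {N} (s≤s sk≤E) | topAfter-colN k (ℕₚ.<⇒≤ sk≤E) =
    step (-1^ k) (+ suc k)
    where
    step : ∀ s t → - s - s · t ≡ - s · (+ 1 + t)
    step = solve-∀

  odd<E : ∀ {i} → i < m → suc (i * 2) < E
  odd<E i<m = ℕₚ.*-monoˡ-≤ 2 i<m

  topAfter-colE-even : ∀ i → i ≤ m → topAfter colE (i * 2) ≡ transitive (i * 2) E
  topAfter-colE-even zero    _   = skew-transitive {N} {0} (s≤s z≤n) (ℕₚ.n<1+n E)
  topAfter-colE-even (suc i) i<m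
    rewrite skew-transitive {N} (s≤s (odd<E i<m)) (ℕₚ.n<1+n E)
          | skew-transitive {N} (s≤s (ℕₚ.<⇒≤ (odd<E i<m))) (ℕₚ.n<1+n E)
          | topAfter-colE-even i (ℕₚ.<⇒≤ i<m)
          | transitive-< (odd<E i<m) | transitive-< (ℕₚ.<-trans (ℕₚ.n<1+n _) (odd<E i<m)) =
    ℤₚ.+-identityʳ _

  topAfter-colE-odd : ∀ {i} → i < m → topAfter colE (suc (i * 2)) ≡ + 0
  topAfter-colE-odd {i} i<m
    rewrite skew-transitive {N} (s≤s (ℕₚ.<⇒≤ (odd<E i<m))) (ℕₚ.n<1+n E)
          | topAfter-colE-even i (ℕₚ.<⇒≤ i<m)
          | transitive-< (odd<E i<m) | transitive-< (ℕₚ.<-trans (ℕₚ.n<1+n _) (odd<E i<m)) = refl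

  bottomAfter-colE : ∀ i → i ≤ m → bottomAfter lastRow colE (i * 2) ≡ - + suc (i * 2)
  bottomAfter-colE zero    _ rewrite skew-lastRow {N} (ℕₚ.n<1+n E) | -1^-even m = refl
  bottomAfter-colE (suc i) i<m
    rewrite bottomAfter-colE i (ℕₚ.<⇒≤ i<m) | topAfter-colE-odd i<m | topAfter-colE-even i (ℕₚ.<⇒≤ i<m)
          | transitive-< (ℕₚ.<-trans (ℕₚ.n<1+n _) (odd<E i<m)) | -1^-even i =
    two-more (+ suc (i * 2)) (lastRow (suc (i * 2)))
    where
    two-more : ∀ a y → - a + + 1 · (- + 1 - + 1) + + 0 · y ≡ - (+ 1 + (+ 1 + a))
    two-more = solve-∀

  det-tournament : detT tournament ≡ + (N * N)
  det-tournament = begin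
    det (skewAdj tournament)
      ≡⟨ det-cong (skewAdj-skewTournament (restrict (skew N)) diagonal antisym unit) ⟩
    det (restrict {suc N} (skew N))
      ≡⟨ det-restrict-differences E (skew N) (ℕₚ.<-trans (ℕₚ.n<1+n E) (ℕₚ.n<1+n N)) ⟨
    det (restrict {suc N} (differences E (skew N)))
      ≡⟨ det-cong (λ r c → differences-skew (toℕ r) (toℕ c) (ℕₚ.≤-pred (Finₚ.toℕ<n r)) (ℕₚ.≤-pred (Finₚ.toℕ<n c))) ⟩
    det (borderedBidiagonal E lastRow colE colN)
      ≡⟨ det-borderedBidiagonal E lastRow colE colN ⟩
    -1^ E · (topAfter colE E · bottomAfter lastRow colN E - topAfter colN E · bottomAfter lastRow colE E)
      ≡⟨ cong₂ (λ s t → -1^ E · (s · bottomAfter lastRow colN E - t · bottomAfter lastRow colE E))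
               (trans (topAfter-colE-even m ℕₚ.≤-refl) (transitive-refl E)) (topAfter-colN E ℕₚ.≤-refl) ⟩
    -1^ E · (+ 0 · bottomAfter lastRow colN E - -1^ E · + N · bottomAfter lastRow colE E)
      ≡⟨ cong₂ (λ s t → s · (+ 0 · bottomAfter lastRow colN E - s · + N · t)) (-1^-even m) (bottomAfter-colE m ℕₚ.≤-refl) ⟩
    + 1 · (+ 0 · bottomAfter lastRow colN E - + 1 · + N · - + N)
      ≡⟨ square (bottomAfter lastRow colN E) (+ N) ⟩
    + (N * N) ∎
    where
    square : ∀ b n → + 1 · (+ 0 · b - + 1 · n · - n) ≡ n · n
    square = solve-∀

-- Positivity of k is implied by its oddness.
theorem4p4 : (k : ℕ) → 0 < k → k % 2 ≡ 1 → Σ ℕ λ n → Σ (Tournament n) λ T → detT T ≡ + (k * k)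
theorem4p4 k _ k-odd =
  suc (suc (m * 2)) , tournament m , trans (det-tournament m) (cong (λ n → + (n * n)) (sym k≡2m+1))
  where
  m : ℕ
  m = k / 2
  k≡2m+1 : k ≡ suc (m * 2)
  k≡2m+1 = trans (m≡m%n+[m/n]*n k 2) (cong (ℕ._+ m * 2) k-odd)
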